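{- Let $k$ and $m$ be positive integers. Then $\bar{R}(m;k)\ge m$. Moreover, $\bar{R}(m;k)=m$ if and only if $k>\binom{m}{2}$.
   Context: For a positive integer $n$, $[n]=\{1,\dots,n\}$. An edge-coloring of $K_n$ with $k$ colors is a map $f:\binom{[n]}{2}\to[k]$; $\alpha_i(f)$ is the independence number of the graph on $[n]$ whose edges are the pairs of color $i$. $\bar{R}(m_1,\dots,m_k)$ is the least positive integer $n$ such that every edge-coloring $f$ of $K_n$ with $k$ colors has some $i$ with $\alpha_i(f)\ge m_i$; $\bar{R}(m;k)$ denotes $\bar{R}(m,\dots,m)$ with $k$ arguments. -}

module Defs where

open import Data.Nat using (ℕ; _≤_; _<_)
open import Data.Fin using (Fin)
open import Data.Fin.Subset using (Subset; _∈_; ∣_∣)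
open import Data.Product using (Σ; _×_; ∃-syntax)
open import Relation.Binary.PropositionalEquality using (_≡_; _≢_)
open import Relation.Nullary using (¬_)

-- An edge-colouring of K_n with k colours: a colour for each unordered
-- pair {x,y} of distinct vertices, represented as a symmetric function
-- (its values on the diagonal x = y are irrelevant and never used).
record Coloring (n k : ℕ) : Set where
  field
    col : Fin n → Fin n → Fin k
    sym : ∀ x y → col x y ≡ col y x
open Coloring public

IndependentIn : ∀ {n k} → Coloring n k → Fin k → Subset n → Set
IndependentIn f i S = ∀ x y → x ∈ S → y ∈ S → x ≢ y → col f x y ≢ i

AlphaAtLeast : ∀ {n k} → Coloring n k → Fin k → ℕ → Set
AlphaAtLeast {n} f i m = ∃[ S ] (IndependentIn f i S × m ≤ ∣ S ∣)

Arrows : (n m k : ℕ) → Set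
Arrows n m k = (f : Coloring n k) → ∃[ i ] AlphaAtLeast f i m

IsRbar : (m k n : ℕ) → Set
IsRbar m k n = 1 ≤ n × Arrows n m k × (∀ n′ → 1 ≤ n′ → n′ < n → ¬ Arrows n′ m k)

-- An independent set of size m in a colouring of K_m must be the whole vertex
-- set, so α_i(f) ≥ m says exactly that colour i is unused.  Hence every
-- k-colouring of K_m has such an i iff every map from the C(m,2) edges to the
-- k colours misses a value, i.e. iff k > C(m,2): one direction is the
-- pigeonhole principle, and for k ≤ C(m,2) some colouring is onto.  For n < m
-- no subset of the n vertices has size m, so R̄(m;k) cannot be smaller than m.
module Submission where

open import Defs
open import Data.Nat using (ℕ; _≤_; _<_; _>_)
open import Data.Nat.Combinatorics using (_C_)
open import Data.Product using (_×_)
open import Function.Bundles using (_⇔_)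

open import Data.Nat using (zero; suc; _+_; _%_; NonZero)
open import Data.Nat.Properties using (≤-trans; ≤-antisym; ≤-reflexive; ≰⇒>; <⇒≱)
open import Data.Nat.DivMod using (_mod_; m<n⇒m%n≡m)
open import Data.Nat.Combinatorics using (nC1≡n; nCk+nC[k+1]≡[n+1]C[k+1])
open import Data.Fin using (Fin; splitAt; join; toℕ; inject≤; _≟_)
open import Data.Fin.Properties
  using (suc-injective; toℕ-injective; toℕ-fromℕ<; toℕ-inject≤; toℕ<n;
         splitAt-join; join-splitAt; injective⇒≤; any?; ¬∀⟶∃¬)
open import Data.Fin.Subset using (Subset; ⊤; _∈_; ∣_∣)
open import Data.Fin.Subset.Properties using (∣p∣≤n; ∣p∣≡n⇒p≡⊤; ∣⊤∣≡n; ∈⊤)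
import Data.Product as Product
open import Data.Product using (_,_; proj₂; uncurry; ∃-syntax)
open import Data.Sum as Sum using (_⊎_; inj₁; inj₂; [_,_]′)
open import Data.Maybe as Maybe using (Maybe; just; nothing; maybe)
open import Data.Empty using (⊥-elim)
open import Function using (_∘_)
open import Function.Bundles using (mk⇔; Equivalence)
open import Relation.Nullary using (¬_)
open import Relation.Binary.PropositionalEquality
  using (_≡_; _≢_; refl; trans; cong; cong₂; subst; module ≡-Reasoning)
  renaming (sym to ≡-sym)

private
  variable
    k m n : ℕ

surjective⇒≤ : (g : Fin n → Fin k) → (∀ i → ∃[ x ] g x ≡ i) → k ≤ n
surjective⇒≤ g onto = injective⇒≤ λ {i} {j} eq →
  trans (≡-sym (proj₂ (onto i))) (trans (cong g eq) (proj₂ (onto j)))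

<⇒missesValue : n < k → (g : Fin n → Fin k) → ∃[ i ] ∀ x → g x ≢ i
<⇒missesValue {k = k} n<k g =
  Product.map₂ (λ ¬hit x gx≡i → ¬hit (x , gx≡i))
    (¬∀⟶∃¬ k _ (λ i → any? (λ x → g x ≟ i))
      (λ onto → <⇒≱ n<k (surjective⇒≤ g onto)))

toℕ-mod-surjective : k ≤ n → .{{_ : NonZero k}} → ∀ i → ∃[ x ] toℕ {n} x mod k ≡ i
toℕ-mod-surjective {k} k≤n i = inject≤ i k≤n , toℕ-injective (begin
  toℕ (toℕ (inject≤ i k≤n) mod k)  ≡⟨ toℕ-fromℕ< _ ⟩
  toℕ (inject≤ i k≤n) % k           ≡⟨ cong (_% k) (toℕ-inject≤ i k≤n) ⟩
  toℕ i % k                         ≡⟨ m<n⇒m%n≡m (toℕ<n i) ⟩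
  toℕ i                             ∎)
  where open ≡-Reasoning

n≤∣p∣⇒∈ : (p : Subset n) → n ≤ ∣ p ∣ → ∀ x → x ∈ p
n≤∣p∣⇒∈ p n≤∣p∣ x =
  subst (x ∈_) (≡-sym (∣p∣≡n⇒p≡⊤ (≤-antisym (∣p∣≤n p) n≤∣p∣))) ∈⊤

edgeCount : ℕ → ℕ
edgeCount zero    = 0
edgeCount (suc m) = m + edgeCount m

edgeCount≡C2 : ∀ m → edgeCount m ≡ m C 2
edgeCount≡C2 zero    = refl
edgeCount≡C2 (suc m) = begin
  m + edgeCount m  ≡⟨ cong₂ _+_ (≡-sym (nC1≡n m)) (edgeCount≡C2 m) ⟩
  m C 1 + m C 2    ≡⟨ nCk+nC[k+1]≡[n+1]C[k+1] m 1 ⟩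
  suc m C 2        ∎
  where open ≡-Reasoning

Edge : ℕ → Set
Edge m = Fin (edgeCount m)

-- The edges of K_{1+m} are the m edges {0, 1+j} followed by the edges of K_m
-- shifted by one.
ends : ∀ m → Edge m → Fin m × Fin m
ends (suc m) e =
  [ (λ j → Fin.zero , Fin.suc j) , (λ e′ → Product.map Fin.suc Fin.suc (ends m e′)) ]′
    (splitAt m e)

edgeBetween : Fin m → Fin m → Maybe (Edge m)
edgeBetween {suc m} Fin.zero    Fin.zero    = nothing
edgeBetween {suc m} Fin.zero    (Fin.suc y) = just (join m _ (inj₁ y))
edgeBetween {suc m} (Fin.suc x) Fin.zero    = just (join m _ (inj₁ x))
edgeBetween {suc m} (Fin.suc x) (Fin.suc y) = Maybe.map (join m _ ∘ inj₂) (edgeBetween x y)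

ends-distinct : ∀ m (e : Edge m) → uncurry _≢_ (ends m e)
ends-distinct (suc m) e with splitAt m e
... | inj₁ _  = λ ()
... | inj₂ e′ = ends-distinct m e′ ∘ suc-injective

ends-join-inj₁ : ∀ j → ends (suc m) (join m _ (inj₁ j)) ≡ (Fin.zero , Fin.suc j)
ends-join-inj₁ {m} j = cong [ _ , _ ]′ (splitAt-join m _ (inj₁ j))

ends-join-inj₂ : ∀ e → ends (suc m) (join m _ (inj₂ e)) ≡ Product.map Fin.suc Fin.suc (ends m e)
ends-join-inj₂ {m} e = cong [ _ , _ ]′ (splitAt-join m _ (inj₂ e))

ends-complete : {x y : Fin m} → x ≢ y → ∃[ e ] (ends m e ≡ (x , y) ⊎ ends m e ≡ (y , x))
ends-complete {suc m} {Fin.zero}  {Fin.zero}  x≢y = ⊥-elim (x≢y refl)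
ends-complete {suc m} {Fin.zero}  {Fin.suc y} _   = join m _ (inj₁ y) , inj₁ (ends-join-inj₁ y)
ends-complete {suc m} {Fin.suc x} {Fin.zero}  _   = join m _ (inj₁ x) , inj₂ (ends-join-inj₁ x)
ends-complete {suc m} {Fin.suc x} {Fin.suc y} x≢y
  with e , orientation ← ends-complete (x≢y ∘ cong Fin.suc)
  = join m _ (inj₂ e) , Sum.map shifted shifted orientation
  where
  shifted : ∀ {a b} → ends m e ≡ (a , b) →
            ends (suc m) (join m _ (inj₂ e)) ≡ (Fin.suc a , Fin.suc b)
  shifted eq = trans (ends-join-inj₂ e) (cong (Product.map Fin.suc Fin.suc) eq)

edgeBetween-comm : (x y : Fin m) → edgeBetween x y ≡ edgeBetween y x
edgeBetween-comm {suc m} Fin.zero    Fin.zero    = refl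
edgeBetween-comm {suc m} Fin.zero    (Fin.suc y) = refl
edgeBetween-comm {suc m} (Fin.suc x) Fin.zero    = refl
edgeBetween-comm {suc m} (Fin.suc x) (Fin.suc y) = cong (Maybe.map _) (edgeBetween-comm x y)

join-splitAt⁻¹ : ∀ {i} {s} → splitAt m i ≡ s → join m n s ≡ i
join-splitAt⁻¹ {m} {n} {i} eq = trans (cong (join m n) (≡-sym eq)) (join-splitAt m n i)

edgeBetween-ends : ∀ m (e : Edge m) → uncurry edgeBetween (ends m e) ≡ just e
edgeBetween-ends (suc m) e with splitAt m e in eq
... | inj₁ _  = cong just (join-splitAt⁻¹ eq)
... | inj₂ e′ =
  trans (cong (Maybe.map (join m _ ∘ inj₂)) (edgeBetween-ends m e′)) (cong just (join-splitAt⁻¹ eq))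

edgeColor : Coloring m k → Edge m → Fin k
edgeColor {m} f = uncurry (col f) ∘ ends m

-- The colour c is only a filler for the diagonal x = y, which has no edge.
fromEdgeColoring : ∀ m → Fin k → (Edge m → Fin k) → Coloring m k
fromEdgeColoring m c g = record
  { col = λ x y → maybe g c (edgeBetween x y)
  ; sym = λ x y → cong (maybe g c) (edgeBetween-comm x y)
  }

edgeColor-fromEdgeColoring : ∀ m (c : Fin k) (g : Edge m → Fin k) e →
                               edgeColor (fromEdgeColoring m c g) e ≡ g e
edgeColor-fromEdgeColoring m c g e = cong (maybe g c) (edgeBetween-ends m e)

AlphaAtLeast-order⇔unused : (f : Coloring m k) (i : Fin k) →
                            AlphaAtLeast f i m ⇔ (∀ e → edgeColor f e ≢ i)
AlphaAtLeast-order⇔unused {m} f i = mk⇔ unused alpha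
  where
  unused : AlphaAtLeast f i m → ∀ e → edgeColor f e ≢ i
  unused (S , independent , m≤∣S∣) e =
    independent _ _ (n≤∣p∣⇒∈ S m≤∣S∣ _) (n≤∣p∣⇒∈ S m≤∣S∣ _) (ends-distinct m e)

  alpha : (∀ e → edgeColor f e ≢ i) → AlphaAtLeast f i m
  alpha never = ⊤ , independent , ≤-reflexive (≡-sym (∣⊤∣≡n m))
    where
    independent : IndependentIn f i ⊤
    independent x y _ _ x≢y fxy≡i with ends-complete x≢y
    ... | e , inj₁ eq = never e (trans (cong (uncurry (col f)) eq) fxy≡i)
    ... | e , inj₂ eq = never e (trans (cong (uncurry (col f)) eq) (trans (Coloring.sym f y x) fxy≡i))

edgeCount<⇒arrows : edgeCount m < k → Arrows m m k
edgeCount<⇒arrows edgeCount<k f =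
  Product.map₂ (Equivalence.from (AlphaAtLeast-order⇔unused f _))
    (<⇒missesValue edgeCount<k (edgeColor f))

≤edgeCount⇒¬arrows : 1 ≤ k → k ≤ edgeCount m → ¬ Arrows m m k
≤edgeCount⇒¬arrows {suc k} {m} _ k≤edgeCount arrows = usesEveryColor (arrows f)
  where
  roundRobin : Edge m → Fin (suc k)
  roundRobin e = toℕ e mod suc k

  f : Coloring m (suc k)
  f = fromEdgeColoring m Fin.zero roundRobin

  usesEveryColor : ¬ (∃[ i ] AlphaAtLeast f i m)
  usesEveryColor (i , alpha) =
    let e , roundRobin-e≡i = toℕ-mod-surjective k≤edgeCount i
    in Equivalence.to (AlphaAtLeast-order⇔unused f i) alpha e
         (trans (edgeColor-fromEdgeColoring m Fin.zero roundRobin e) roundRobin-e≡i)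

arrows⇒≤ : 1 ≤ k → Arrows n m k → m ≤ n
arrows⇒≤ {suc k} _ arrows
  with _ , S , _ , m≤∣S∣ ← arrows (record { col = λ _ _ → Fin.zero ; sym = λ _ _ → refl })
  = ≤-trans m≤∣S∣ (∣p∣≤n S)

lemma2p6 : (k m : ℕ) → 1 ≤ k → 1 ≤ m →
    ((n : ℕ) → IsRbar m k n → m ≤ n) × (IsRbar m k m ⇔ k > m C 2)
lemma2p6 k m 1≤k 1≤m = (λ _ (_ , arrows , _) → arrows⇒≤ 1≤k arrows) , mk⇔ bound rbar
  where
  bound : IsRbar m k m → k > m C 2
  bound (_ , arrows , _) =
    subst (_< k) (edgeCount≡C2 m) (≰⇒> λ k≤edgeCount → ≤edgeCount⇒¬arrows 1≤k k≤edgeCount arrows)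

  rbar : k > m C 2 → IsRbar m k m
  rbar C2<k = 1≤m , edgeCount<⇒arrows (subst (_< k) (≡-sym (edgeCount≡C2 m)) C2<k)
            , λ _ _ n<m arrows → <⇒≱ n<m (arrows⇒≤ 1≤k arrows)
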